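{- There exists a finite graph $G$ with a connected subgraph $H$ such that $B(H) > B(G)$.
   Context: Bodyguards and Presidents is a two-player game on a finite simple graph $G$. One player controls a set of tokens called bodyguards, the other a single token called the president. First all bodyguards are placed on vertices (several may share a vertex), then the president is placed. The players then alternate turns, bodyguards first; on a player's turn, each token they control either moves to an adjacent vertex or stays put. The president is surrounded if every vertex of the open neighbourhood of the president's vertex is occupied by a bodyguard. The bodyguards win if there is a finite time after which, at the end of every bodyguard turn, the president is surrounded; otherwise the president wins. The bodyguard number $B(G)$ is the minimum number of bodyguards that guarantees a win for the bodyguards on $G$ (with $B(G)=0$ for the edgeless graph). -}

module Defs where

open import Data.Nat using (ℕ; zero; suc; _≤_; _<_)
open import Data.Fin using (Fin)
open import Data.List using (List; []; _∷_)
open import Data.Product using (Σ; ∃; _×_; _,_)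
open import Data.Sum using (_⊎_)
open import Relation.Nullary using (¬_)
open import Relation.Binary.PropositionalEquality using (_≡_)
open import Relation.Binary.Construct.Closure.ReflexiveTransitive using (Star)
open import Function.Definitions using (Injective)

record SimpleGraph (n : ℕ) : Set₁ where
  field
    Adj     : Fin n → Fin n → Set
    sym     : ∀ {u v} → Adj u v → Adj v u
    irrefl  : ∀ {u} → ¬ Adj u u
open SimpleGraph public

StepOrStay : ∀ {n} → SimpleGraph n → Fin n → Fin n → Set
StepOrStay G u v = u ≡ v ⊎ Adj G u v

Config : ℕ → ℕ → Set
Config n k = Fin k → Fin n

Surrounded : ∀ {n k} → SimpleGraph n → Config n k → Fin n → Set
Surrounded {k = k} G c p = ∀ v → Adj G p v → Σ (Fin k) λ i → c i ≡ v

-- A (deterministic) bodyguard strategy: given the history of president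
-- positions (most recent first), the bodyguard configuration to adopt.
-- strategy [] is the initial placement; after the president has occupied
-- p₀, …, pₙ, the bodyguards move to strategy (pₙ ∷ … ∷ p₀ ∷ []).
record BodyguardStrategy {n : ℕ} (G : SimpleGraph n) (k : ℕ) : Set where
  field
    strategy : List (Fin n) → Config n k
    legal    : ∀ p ps (i : Fin k) →
               StepOrStay G (strategy ps i) (strategy (p ∷ ps) i)
open BodyguardStrategy public

record PresidentPlay {n : ℕ} (G : SimpleGraph n) : Set where
  field
    pos   : ℕ → Fin n
    legal : ∀ t → StepOrStay G (pos t) (pos (suc t))
open PresidentPlay public

history : ∀ {n} {G : SimpleGraph n} → PresidentPlay G → ℕ → List (Fin n)
history P zero    = []
history P (suc t) = pos P t ∷ history P t

-- Bodyguards win with the strategy against the play: from some time on,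
-- at the end of every bodyguard turn the president is surrounded.
-- (At the end of the bodyguard turn following the president's t-th
-- placement/move, the president is at pos t and bodyguards at
-- strategy (history (suc t)).)
WinsAgainst : ∀ {n k} {G : SimpleGraph n} →
              BodyguardStrategy G k → PresidentPlay G → Set
WinsAgainst {G = G} σ P =
  Σ ℕ λ N → ∀ t → N ≤ t →
    Surrounded G (strategy σ (history P (suc t))) (pos P t)

BodyguardsWin : ∀ {n} → SimpleGraph n → ℕ → Set
BodyguardsWin G k =
  Σ (BodyguardStrategy G k) λ σ → ∀ (P : PresidentPlay G) → WinsAgainst σ P

IsBodyguardNumber : ∀ {n} → SimpleGraph n → ℕ → Set
IsBodyguardNumber G b = BodyguardsWin G b × (∀ j → j < b → ¬ BodyguardsWin G j)

record SubgraphEmbedding {m n : ℕ} (H : SimpleGraph m) (G : SimpleGraph n) : Set where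
  field
    vmap     : Fin m → Fin n
    injective : Injective _≡_ _≡_ vmap
    edges    : ∀ {u v} → Adj H u v → Adj G (vmap u) (vmap v)

Connected : ∀ {n} → SimpleGraph n → Set
Connected G = ∀ u v → Star (Adj G) u v

{-# OPTIONS --safe #-}
-- H is the double star: adjacent centres a and b with leaves a₁, a₂ and
-- b₁, b₂; G adds the rungs a₁b₁ and a₂b₂. In both graphs a has degree 3, so
-- a president who never moves forces three bodyguards, and explicit
-- strategies that answer each president position with a fixed surrounding
-- configuration show that three suffice on G and four on H. Three do not
-- suffice on H: the president starts at a and crosses the edge ab whenever
-- he is surrounded. Guards surrounding a include two on a₁ and a₂; to
-- surround b one move later two further guards must stand on b₁ and b₂, and
-- in H nobody gets from {a₁, a₂} to {b₁, b₂} in one move, so four distinct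
-- guards would be needed. The rungs of G are exactly these missing moves.
module Submission where

open import Defs hiding (sym)
open import Data.Bool using (Bool; true; false; not)
open import Data.Empty using (⊥-elim)
open import Data.Fin using (Fin; zero; suc; splitAt; join)
open import Data.Fin.Properties using (_≟_; all?; any?; injective⇒≤; join-splitAt)
open import Data.List using (List; []; _∷_; _++_)
open import Data.List.Membership.Propositional using (_∈_)
open import Data.List.Membership.Propositional.Properties using (∈-++⁺ˡ)
open import Data.List.Relation.Unary.All as All using (All; []; _∷_)
import Data.List.Relation.Unary.All.Properties as Allₚ
open import Data.Maybe using (Maybe; just; nothing)
open import Data.Nat using (ℕ; zero; suc; _+_; _≤_; _<_)
open import Data.Nat.Properties using (≤-refl; n≤1+n; <⇒≱; m<1+n⇒m<n∨m≡n)
open import Data.Product using (Σ; ∃; _×_; _,_; proj₁; proj₂; uncurry)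
import Data.Product.Properties as Product
open import Data.Sum using (_⊎_; inj₁; inj₂; [_,_]; [_,_]′)
import Data.Sum as Sum
open import Data.Vec.Functional using () renaming ([] to ⟨⟩; _∷_ to _◂_)
open import Function using (_∘_)
open import Function.Definitions using (Injective)
open import Relation.Binary.Construct.Closure.ReflexiveTransitive using (Star; ε; _◅_; _◅◅_; reverse)
open import Relation.Binary.Definitions using (Decidable)
open import Relation.Binary.PropositionalEquality
  using (_≡_; _≢_; refl; sym; trans; cong; subst; subst₂; module ≡-Reasoning)
open import Relation.Nullary using (¬_; Dec; yes; no)
open import Relation.Nullary.Decidable using (True; toWitness; _⊎-dec_; _→-dec_; ¬?)

private
  variable
    n k d s t : ℕ

injective-copair : ∀ {A B C : Set} {f : A → C} {g : B → C} →
                   Injective _≡_ _≡_ f → Injective _≡_ _≡_ g → (∀ x y → f x ≢ g y) →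
                   Injective _≡_ _≡_ [ f , g ]′
injective-copair f-inj g-inj apart {inj₁ x} {inj₁ y} eq = cong inj₁ (f-inj eq)
injective-copair f-inj g-inj apart {inj₁ x} {inj₂ y} eq = ⊥-elim (apart x y eq)
injective-copair f-inj g-inj apart {inj₂ x} {inj₁ y} eq = ⊥-elim (apart y x (sym eq))
injective-copair f-inj g-inj apart {inj₂ x} {inj₂ y} eq = cong inj₂ (g-inj eq)

splitAt-injective : ∀ s {t} → Injective _≡_ _≡_ (splitAt s {t})
splitAt-injective s {t} {i} {j} eq = begin
  i                      ≡⟨ join-splitAt s t i ⟨
  join s t (splitAt s i) ≡⟨ cong (join s t) eq ⟩
  join s t (splitAt s j) ≡⟨ join-splitAt s t j ⟩
  j                      ∎
  where open ≡-Reasoning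

OneMove : SimpleGraph n → Config n k → Config n k → Set
OneMove G c c′ = ∀ i → StepOrStay G (c i) (c′ i)

NoShift : SimpleGraph n → ℕ → Fin n → Fin n → Set
NoShift {n} G k p q = ∀ {c c′ : Config n k} →
  Surrounded G c p → OneMove G c c′ → ¬ Surrounded G c′ q

record Neighbours (G : SimpleGraph n) (p : Fin n) (d : ℕ) : Set where
  field
    vertex   : Fin d → Fin n
    distinct : Injective _≡_ _≡_ vertex
    adjacent : ∀ i → Adj G p (vertex i)
open Neighbours

module _ {G : SimpleGraph n} {c : Config n k} {p : Fin n} (surrounded : Surrounded G c p)
         (N : Neighbours G p d) where

  guard : Fin d → Fin k
  guard i = proj₁ (surrounded (vertex N i) (adjacent N i))

  guard-at : ∀ i → c (guard i) ≡ vertex N i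
  guard-at i = proj₂ (surrounded (vertex N i) (adjacent N i))

  guard-injective : Injective _≡_ _≡_ guard
  guard-injective {i} {j} eq = distinct N (begin
    vertex N i   ≡⟨ guard-at i ⟨
    c (guard i)  ≡⟨ cong c eq ⟩
    c (guard j)  ≡⟨ guard-at j ⟩
    vertex N j   ∎)
    where open ≡-Reasoning

surrounded⇒degree≤ : ∀ {G : SimpleGraph n} {c : Config n k} {p} →
                     Neighbours G p d → Surrounded G c p → d ≤ k
surrounded⇒degree≤ N surrounded = injective⇒≤ (guard-injective surrounded N)

-- The guards on U before the move and those on W after it are all distinct,
-- because no guard can get from a vertex of U to one of W in a single move.
shift⇒≤ : ∀ {G : SimpleGraph n} {c c′ : Config n k} {p q}
          (U : Neighbours G p s) (W : Neighbours G q t) →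
          (∀ i j → ¬ StepOrStay G (vertex U i) (vertex W j)) →
          Surrounded G c p → OneMove G c c′ → Surrounded G c′ q → s + t ≤ k
shift⇒≤ {s = s} {G = G} {c′ = c′} U W far surrounded move surrounded′ =
  injective⇒≤ (splitAt-injective s ∘
                injective-copair (guard-injective surrounded U) (guard-injective surrounded′ W) apart)
  where
  apart : ∀ i j → guard surrounded U i ≢ guard surrounded′ W j
  apart i j eq = far i j (subst₂ (StepOrStay G) (guard-at surrounded U i)
                                 (trans (cong c′ eq) (guard-at surrounded′ W j))
                                 (move (guard surrounded U i)))

separated⇒noShift : ∀ {G : SimpleGraph n} {p q} (U : Neighbours G p s) (W : Neighbours G q t) →
                    (∀ i j → ¬ StepOrStay G (vertex U i) (vertex W j)) →
                    k < s + t → NoShift G k p q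
separated⇒noShift U W far k<s+t surrounded move surrounded′ =
  <⇒≱ k<s+t (shift⇒≤ U W far surrounded move surrounded′)

module _ {G : SimpleGraph n} where

  stay : Fin n → PresidentPlay G
  stay p = record { pos = λ _ → p ; legal = λ _ → inj₁ refl }

  win⇒surroundable : BodyguardsWin G k → ∀ p → ∃ λ (c : Config n k) → Surrounded G c p
  win⇒surroundable (σ , wins) p = let N , surrounded = wins (stay p) in _ , surrounded N ≤-refl

  win⇒degree≤ : ∀ {p} → Neighbours G p d → BodyguardsWin G k → d ≤ k
  win⇒degree≤ {p = p} N win = surrounded⇒degree≤ N (proj₂ (win⇒surroundable win p))

record PositionalStrategy (G : SimpleGraph n) (k : ℕ) : Set where
  field
    start     : Config n k
    respond   : Fin n → Config n k
    reachable : ∀ p → OneMove G start (respond p)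
    tracks    : ∀ {p q} → StepOrStay G p q → OneMove G (respond p) (respond q)
    surrounds : ∀ p → Surrounded G (respond p) p

injective? : (f : Fin d → Fin n) → Dec (∀ i j → f i ≡ f j → i ≡ j)
injective? f = all? λ i → all? λ j → f i ≟ f j →-dec i ≟ j

-- The implicit True (…) side conditions below evaluate to ⊤ on a concrete
-- graph, so they are discharged by computation.
module Decision {G : SimpleGraph n} (adj? : Decidable (Adj G)) where

  stepOrStay? : Decidable (StepOrStay G)
  stepOrStay? u v = (u ≟ v) ⊎-dec adj? u v

  surrounded? : (c : Config n k) (p : Fin n) → Dec (Surrounded G c p)
  surrounded? c p = all? λ v → adj? p v →-dec any? λ i → c i ≟ v

  oneMove? : (c c′ : Config n k) → Dec (OneMove G c c′)
  oneMove? c c′ = all? λ i → stepOrStay? (c i) (c′ i)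

  edge : ∀ {u v} {_ : True (adj? u v)} → Adj G u v
  edge {_} {_} {isEdge} = toWitness isEdge

  neighbours : ∀ p (f : Fin d → Fin n) →
               {_ : True (injective? f)} {_ : True (all? λ i → adj? p (f i))} → Neighbours G p d
  neighbours p f {distinct} {adjacent} = record
    { vertex   = f
    ; distinct = λ {i} {j} → toWitness distinct i j
    ; adjacent = toWitness adjacent }

  far : ∀ (U : Fin s → Fin n) (W : Fin t → Fin n) →
        {_ : True (all? λ i → all? λ j → ¬? (stepOrStay? (U i) (W j)))} →
        ∀ i j → ¬ StepOrStay G (U i) (W j)
  far U W {isFar} = toWitness isFar

  positionalStrategy :
    (start : Config n k) (respond : Fin n → Config n k) →
    {_ : True (all? λ p → oneMove? start (respond p))} →
    {_ : True (all? λ p → all? λ q → stepOrStay? p q →-dec oneMove? (respond p) (respond q))} →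
    {_ : True (all? λ p → surrounded? (respond p) p)} →
    PositionalStrategy G k
  positionalStrategy start respond {reachable} {tracks} {surrounds} = record
    { start     = start
    ; respond   = respond
    ; reachable = toWitness reachable
    ; tracks    = λ {p} {q} → toWitness tracks p q
    ; surrounds = toWitness surrounds }

module _ {G : SimpleGraph n} (adj? : Decidable (Adj G)) (π : PositionalStrategy G k) where
  open PositionalStrategy π
  open Decision {G = G} adj? using (stepOrStay?)

  -- A strategy must answer every history legally, including impossible
  -- ones, so illegal president moves are ignored.
  advance : Maybe (Fin n) → Fin n → Maybe (Fin n)
  advance nothing  p = just p
  advance (just q) p with stepOrStay? q p
  ... | yes _ = just p
  ... | no  _ = just q

  lastLegal : List (Fin n) → Maybe (Fin n)
  lastLegal []       = nothing
  lastLegal (p ∷ ps) = advance (lastLegal ps) p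

  configFor : Maybe (Fin n) → Config n k
  configFor nothing  = start
  configFor (just p) = respond p

  advance-legal : ∀ m p → OneMove G (configFor m) (configFor (advance m p))
  advance-legal nothing  p = reachable p
  advance-legal (just q) p with stepOrStay? q p
  ... | yes step = tracks step
  ... | no  _    = λ _ → inj₁ refl

  positional : BodyguardStrategy G k
  positional = record
    { strategy = configFor ∘ lastLegal
    ; legal    = λ p ps → advance-legal (lastLegal ps) p }

  lastLegal-history : (P : PresidentPlay G) → ∀ t → lastLegal (history P (suc t)) ≡ just (pos P t)
  lastLegal-history P zero = refl
  lastLegal-history P (suc t) rewrite lastLegal-history P t
    with stepOrStay? (pos P t) (pos P (suc t))
  ... | yes _      = refl
  ... | no ¬step   = ⊥-elim (¬step (legal P t))

  positional-wins : ∀ P → WinsAgainst positional P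
  positional-wins P = 0 , λ t _ →
    subst (λ m → Surrounded G (configFor m) (pos P t)) (sym (lastLegal-history P t))
          (surrounds (pos P t))

  positional⇒win : BodyguardsWin G k
  positional⇒win = positional , positional-wins

module _ {G : SimpleGraph n} (adj? : Decidable (Adj G)) {p q : Fin n} (pq : Adj G p q) where
  open Decision {G = G} adj? using (surrounded?)

  at : Bool → Fin n
  at true  = p
  at false = q

  across : ∀ s → Adj G (at s) (at (not s))
  across true  = pq
  across false = SimpleGraph.sym G pq

  dodge : Config n k → Bool → Bool
  dodge c s with surrounded? c (at s)
  ... | yes _ = not s
  ... | no  _ = s

  dodge-legal : ∀ (c : Config n k) s → StepOrStay G (at s) (at (dodge c s))
  dodge-legal c s with surrounded? c (at s)
  ... | yes _ = inj₂ (across s)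
  ... | no  _ = inj₁ refl

  dodge-surrounded : ∀ {c : Config n k} {s} → Surrounded G c (at s) → dodge c s ≡ not s
  dodge-surrounded {c = c} {s} surrounded with surrounded? c (at s)
  ... | yes _          = refl
  ... | no ¬surrounded = ⊥-elim (¬surrounded surrounded)

  module _ (σ : BodyguardStrategy G k) where

    side    : ℕ → Bool
    visited : ℕ → List (Fin n)
    side zero    = true
    side (suc t) = dodge (strategy σ (visited (suc t))) (side t)
    visited zero    = []
    visited (suc t) = at (side t) ∷ visited t

    dancer : PresidentPlay G
    dancer = record { pos = at ∘ side ; legal = λ t → dodge-legal _ (side t) }

    history-dancer : ∀ t → history dancer t ≡ visited t
    history-dancer zero    = refl
    history-dancer (suc t) = cong (at (side t) ∷_) (history-dancer t)

    dancer-escapes : NoShift G k p q → NoShift G k q p → ¬ WinsAgainst σ dancer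
    dancer-escapes p↛q q↛p (N , surrounded) =
      noShift (side N) surrounded₁ (legal σ (at (side (suc N))) (visited (suc N)))
        (subst (Surrounded G c′ ∘ at) (dodge-surrounded surrounded₁) surrounded₂)
      where
      surroundedAt : ∀ t → N ≤ t → Surrounded G (strategy σ (visited (suc t))) (at (side t))
      surroundedAt t N≤t = subst (λ h → Surrounded G (strategy σ h) (at (side t)))
                                 (history-dancer (suc t)) (surrounded t N≤t)

      c′ : Config n k
      c′ = strategy σ (visited (suc (suc N)))

      surrounded₁ : Surrounded G (strategy σ (visited (suc N))) (at (side N))
      surrounded₁ = surroundedAt N ≤-refl

      surrounded₂ : Surrounded G c′ (at (side (suc N)))
      surrounded₂ = surroundedAt (suc N) (n≤1+n N)

      noShift : ∀ s → NoShift G k (at s) (at (not s))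
      noShift true  = p↛q
      noShift false = q↛p

  noShifts⇒¬win : NoShift G k p q → NoShift G k q p → ¬ BodyguardsWin G k
  noShifts⇒¬win p↛q q↛p (σ , wins) = dancer-escapes σ p↛q q↛p (wins (dancer σ))

Loopless : List (Fin n × Fin n) → Set
Loopless = All (uncurry _≢_)

Joins : List (Fin n × Fin n) → Fin n → Fin n → Set
Joins es u v = (u , v) ∈ es ⊎ (v , u) ∈ es

joins? : ∀ (es : List (Fin n × Fin n)) → Decidable (Joins es)
joins? {n} es u v = ((u , v) ∈? es) ⊎-dec ((v , u) ∈? es)
  where
  open import Data.List.Membership.DecPropositional (Product.≡-dec (_≟_ {n}) (_≟_ {n}))
    using (_∈?_)

fromEdges : (es : List (Fin n × Fin n)) → Loopless es → SimpleGraph n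
fromEdges es loopless = record
  { Adj    = Joins es
  ; sym    = Sum.swap
  ; irrefl = [ loop , loop ] }
  where
  loop : ∀ {u} → ¬ (u , u) ∈ es
  loop uu = All.lookup loopless uu refl

fromEdges-++ : ∀ {es es′ : List (Fin n × Fin n)} (ok : Loopless es) (ok′ : Loopless (es ++ es′)) →
               SubgraphEmbedding (fromEdges es ok) (fromEdges (es ++ es′) ok′)
fromEdges-++ _ _ = record
  { vmap      = λ u → u
  ; injective = λ eq → eq
  ; edges     = Sum.map ∈-++⁺ˡ ∈-++⁺ˡ }

reaches-all⇒connected : ∀ {G : SimpleGraph n} {r} → (∀ u → Star (Adj G) u r) → Connected G
reaches-all⇒connected {G = G} toRoot u v = toRoot u ◅◅ reverse (SimpleGraph.sym G) (toRoot v)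

pattern a  = zero
pattern b  = suc zero
pattern a₁ = suc (suc zero)
pattern a₂ = suc (suc (suc zero))
pattern b₁ = suc (suc (suc (suc zero)))
pattern b₂ = suc (suc (suc (suc (suc zero))))

doubleStar : List (Fin 6 × Fin 6)
doubleStar = (a , b) ∷ (a , a₁) ∷ (a , a₂) ∷ (b , b₁) ∷ (b , b₂) ∷ []

rungs : List (Fin 6 × Fin 6)
rungs = (a₁ , b₁) ∷ (a₂ , b₂) ∷ []

doubleStar-loopless : Loopless doubleStar
doubleStar-loopless = (λ ()) ∷ (λ ()) ∷ (λ ()) ∷ (λ ()) ∷ (λ ()) ∷ []

G-loopless : Loopless (doubleStar ++ rungs)
G-loopless = Allₚ.++⁺ doubleStar-loopless ((λ ()) ∷ (λ ()) ∷ [])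

H : SimpleGraph 6
H = fromEdges doubleStar doubleStar-loopless

G : SimpleGraph 6
G = fromEdges (doubleStar ++ rungs) G-loopless

H⊆G : SubgraphEmbedding H G
H⊆G = fromEdges-++ doubleStar-loopless G-loopless

module DH = Decision {G = H} (joins? doubleStar)
module DG = Decision {G = G} (joins? (doubleStar ++ rungs))

H-connected : Connected H
H-connected = reaches-all⇒connected {G = H} toA
  where
  toA : ∀ u → Star (Adj H) u a
  toA a  = ε
  toA b  = DH.edge ◅ ε
  toA a₁ = DH.edge ◅ ε
  toA a₂ = DH.edge ◅ ε
  toA b₁ = DH.edge {v = b} ◅ DH.edge ◅ ε
  toA b₂ = DH.edge {v = b} ◅ DH.edge ◅ ε

H-strategy : PositionalStrategy H 4
H-strategy = DH.positionalStrategy (a ◂ b ◂ a ◂ b ◂ ⟨⟩) respond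
  where
  respond : Fin 6 → Config 6 4
  respond a  = a₁ ◂ b  ◂ a₂ ◂ b  ◂ ⟨⟩
  respond b  = a  ◂ b₂ ◂ a  ◂ b₁ ◂ ⟨⟩
  respond a₁ = a  ◂ a  ◂ a  ◂ a  ◂ ⟨⟩
  respond a₂ = a  ◂ a  ◂ a  ◂ a  ◂ ⟨⟩
  respond b₁ = a  ◂ b  ◂ a  ◂ b  ◂ ⟨⟩
  respond b₂ = a  ◂ b  ◂ a  ◂ b  ◂ ⟨⟩

G-strategy : PositionalStrategy G 3
G-strategy = DG.positionalStrategy (a ◂ b ◂ a₁ ◂ ⟨⟩) respond
  where
  respond : Fin 6 → Config 6 3
  respond a  = a₂ ◂ b  ◂ a₁ ◂ ⟨⟩
  respond b  = a  ◂ b₂ ◂ b₁ ◂ ⟨⟩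
  respond a₁ = a  ◂ a  ◂ b₁ ◂ ⟨⟩
  respond a₂ = a  ◂ b₂ ◂ a  ◂ ⟨⟩
  respond b₁ = a  ◂ b  ◂ a₁ ◂ ⟨⟩
  respond b₂ = a₂ ◂ b  ◂ a₁ ◂ ⟨⟩

leavesOfA : Neighbours H a 2
leavesOfA = DH.neighbours a (a₁ ◂ a₂ ◂ ⟨⟩)

leavesOfB : Neighbours H b 2
leavesOfB = DH.neighbours b (b₁ ◂ b₂ ◂ ⟨⟩)

H-noShift-ab : NoShift H 3 a b
H-noShift-ab = separated⇒noShift leavesOfA leavesOfB
                 (DH.far (vertex leavesOfA) (vertex leavesOfB)) ≤-refl

H-noShift-ba : NoShift H 3 b a
H-noShift-ba = separated⇒noShift leavesOfB leavesOfA
                 (DH.far (vertex leavesOfB) (vertex leavesOfA)) ≤-refl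

H-bodyguardNumber : IsBodyguardNumber H 4
H-bodyguardNumber = positional⇒win (joins? doubleStar) H-strategy , lose
  where
  lose : ∀ j → j < 4 → ¬ BodyguardsWin H j
  lose j j<4 with m<1+n⇒m<n∨m≡n j<4
  ... | inj₁ j<3  = <⇒≱ j<3 ∘ win⇒degree≤ (DH.neighbours a (b ◂ a₁ ◂ a₂ ◂ ⟨⟩))
  ... | inj₂ refl = noShifts⇒¬win (joins? doubleStar) DH.edge H-noShift-ab H-noShift-ba

G-bodyguardNumber : IsBodyguardNumber G 3
G-bodyguardNumber = positional⇒win (joins? (doubleStar ++ rungs)) G-strategy ,
                    λ j j<3 → <⇒≱ j<3 ∘ win⇒degree≤ (DG.neighbours a (b ◂ a₁ ◂ a₂ ◂ ⟨⟩))

mainTheorem3 : Σ ℕ λ n → Σ (SimpleGraph n) λ G →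
               Σ ℕ λ m → Σ (SimpleGraph m) λ H →
               SubgraphEmbedding H G × Connected H ×
               (Σ ℕ λ bG → Σ ℕ λ bH →
                 IsBodyguardNumber G bG × IsBodyguardNumber H bH × bG < bH)
mainTheorem3 = 6 , G , 6 , H , H⊆G , H-connected , 3 , 4 , G-bodyguardNumber , H-bodyguardNumber , ≤-refl
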